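{- Let $G$ be a graph with $n$ vertices and $k\in\mathbb{N}$. There is a local $L$-sequence of length $k$ in $G$ if and only if there is a $\{T,D\}$-forcing set of size $n-k$ in $G$.
   Context: For a vertex $v$, $N(v)$ is the open and $N[v]=N(v)\cup\{v\}$ the closed neighborhood. A sequence $(v_1,\dots,v_k)$ of pairwise distinct vertices of $G$ is a \emph{local $L$-sequence} if for all $i$ the set $(N[v_i]\cap\{v_1,\dots,v_i\})\setminus\bigcup_{j=1}^{i-1}N(v_j)$ is nonempty. Vertices are colored blue or white. \emph{$T$-rule}: if $v$ is white and has exactly one white neighbor $w$, color $w$ blue. \emph{$D$-rule}: if $v$ is white and every neighbor of $v$ is blue, color $v$ blue. A set $S\subseteq V(G)$ is a \emph{$\{T,D\}$-forcing set} if, starting with $S$ blue and all other vertices white, iteratively applying $T$-rules and $D$-rules can color all vertices blue. -}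

module Defs where

open import Data.Nat using (ℕ)
open import Data.Bool using (Bool; true; false; T)
open import Data.Fin using (Fin; _≤_; _<_)
open import Data.Fin.Subset using (Subset; _∈_; _∉_; inside; ⊤)
open import Data.Vec using (Vec; lookup; _[_]≔_)
open import Data.Product using (Σ; _×_; ∃; ∃-syntax)
open import Data.Sum using (_⊎_)
open import Relation.Nullary using (¬_)
open import Relation.Binary.PropositionalEquality using (_≡_)
open import Function.Definitions using (Injective)

record Graph (n : ℕ) : Set where
  field
    adj    : Fin n → Fin n → Bool
    sym    : ∀ u v → adj u v ≡ adj v u
    irrefl : ∀ v → adj v v ≡ false

open Graph public

Adj : ∀ {n} → Graph n → Fin n → Fin n → Set
Adj G v u = T (adj G v u)

ClosedNbr : ∀ {n} → Graph n → Fin n → Fin n → Set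
ClosedNbr G v u = (u ≡ v) ⊎ Adj G v u

IsLocalLSeq : ∀ {n k} → Graph n → Vec (Fin n) k → Set
IsLocalLSeq {n} {k} G vs =
  Injective _≡_ _≡_ (lookup vs) ×
  (∀ (i : Fin k) → ∃[ u ]
     (ClosedNbr G (lookup vs i) u ×
      (∃[ j ] (j ≤ i × lookup vs j ≡ u)) ×
      (∀ (j : Fin k) → j < i → ¬ Adj G (lookup vs j) u)))

-- Blue vertices form a Subset n (inside = blue).
-- CanColor G c w : one T-rule or D-rule application to coloring c colors w blue.
data CanColor {n} (G : Graph n) (c : Subset n) : Fin n → Set where
  T-rule : ∀ v w → v ∉ c → w ∉ c → Adj G v w →
           (∀ u → Adj G v u → u ∉ c → u ≡ w) → CanColor G c w
  D-rule : ∀ v → v ∉ c → (∀ u → Adj G v u → u ∈ c) → CanColor G c v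

data Forces {n} (G : Graph n) : Subset n → Subset n → Set where
  done : ∀ {c} → Forces G c c
  step : ∀ {c d} w → CanColor G c w → Forces G (c [ w ]≔ inside) d → Forces G c d

IsTDForcing : ∀ {n} → Graph n → Subset n → Set
IsTDForcing G S = Forces G S ⊤

{-# OPTIONS --safe #-}
-- If exactly v₁,…,vᵢ are white, the rules can colour vᵢ iff some u ∈ N[vᵢ] ∩ {v₁,…,vᵢ} has
-- no neighbour among v₁,…,vᵢ₋₁: for u = vᵢ this is the D-rule at vᵢ, otherwise the T-rule
-- at u, whose only white neighbour is then vᵢ. Hence a local L-sequence of length k, coloured
-- from its last vertex back to its first, is a forcing process from its complement, a set of
-- size n − k; conversely the vertices coloured by a forcing process, in reverse order, form a
-- local L-sequence.
module Submission where

open import Defs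
open import Data.Nat using (ℕ; zero; suc; _+_)
import Data.Nat as ℕ
import Data.Nat.Properties as ℕₚ
open import Data.Bool using (T)
open import Data.Empty using (⊥; ⊥-elim)
open import Data.Fin using (Fin; zero; suc; toℕ; fromℕ; inject₁; _≤_; _<_; _≟_)
open import Data.Fin.Properties
  using (toℕ-inject₁; toℕ-fromℕ; inject₁ℕ<; ≤fromℕ; fromℕ≢inject₁; inject₁-injective; <-irrefl)
open import Data.Fin.Relation.Unary.Top using (view; ‵fromℕ; ‵inject₁)
open import Data.Fin.Subset using (Subset; ∣_∣; inside; outside; ⊤; ∁; _∈_; _∉_)
  renaming (⊥ to ∅)
open import Data.Fin.Subset.Properties
  using (∈⊤; ∉⊥; ⊆⊤; ⊆-antisym; ∣⊤∣≡n; _∈?_; x∉∁p⇒x∈p; x∈p⇒x∉∁p)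
open import Data.Vec using (Vec; []; _∷_; _∷ʳ_; lookup; _[_]≔_; here; there; initLast)
open import Data.Vec.Properties using ([]≔-updates; []≔-minimal)
open import Data.Product using (∃₂; ∃-syntax; _×_; _,_; proj₁)
open import Data.Sum as Sum using (_⊎_; inj₁; inj₂)
open import Function using (_∘_)
open import Function.Bundles using (_⇔_; mk⇔; Equivalence)
open import Function.Definitions using (Injective)
open import Relation.Nullary using (¬_; yes; no; contradiction)
open import Relation.Nullary.Decidable using (decidable-stable)
open import Relation.Binary.PropositionalEquality
  using (_≡_; refl; trans; cong; subst; subst₂; module ≡-Reasoning)
  renaming (sym to ≡-sym)

open Equivalence using (to; from)

private
  variable
    A : Set
    n k : ℕ

inject₁<fromℕ : (i : Fin k) → inject₁ i < fromℕ k
inject₁<fromℕ {k} i = subst (toℕ (inject₁ i) ℕ.<_) (≡-sym (toℕ-fromℕ k)) (inject₁ℕ< i)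

fromℕ≰inject₁ : (i : Fin k) → ¬ fromℕ k ≤ inject₁ i
fromℕ≰inject₁ i = ℕₚ.<⇒≱ (inject₁<fromℕ i)

inject₁-mono-≤ : {i j : Fin k} → i ≤ j → inject₁ i ≤ inject₁ j
inject₁-mono-≤ {i = i} {j} = subst₂ ℕ._≤_ (≡-sym (toℕ-inject₁ i)) (≡-sym (toℕ-inject₁ j))

inject₁-cancel-≤ : {i j : Fin k} → inject₁ i ≤ inject₁ j → i ≤ j
inject₁-cancel-≤ {i = i} {j} = subst₂ ℕ._≤_ (toℕ-inject₁ i) (toℕ-inject₁ j)

inject₁-mono-< : {i j : Fin k} → i < j → inject₁ i < inject₁ j
inject₁-mono-< {i = i} {j} = subst₂ ℕ._<_ (≡-sym (toℕ-inject₁ i)) (≡-sym (toℕ-inject₁ j))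

inject₁-cancel-< : {i j : Fin k} → inject₁ i < inject₁ j → i < j
inject₁-cancel-< {i = i} {j} = subst₂ ℕ._<_ (toℕ-inject₁ i) (toℕ-inject₁ j)

lookup-∷ʳ-fromℕ : (xs : Vec A k) (x : A) → lookup (xs ∷ʳ x) (fromℕ k) ≡ x
lookup-∷ʳ-fromℕ []       x = refl
lookup-∷ʳ-fromℕ (_ ∷ xs) x = lookup-∷ʳ-fromℕ xs x

lookup-∷ʳ-inject₁ : (xs : Vec A k) (x : A) (i : Fin k) → lookup (xs ∷ʳ x) (inject₁ i) ≡ lookup xs i
lookup-∷ʳ-inject₁ (_ ∷ xs) x zero    = refl
lookup-∷ʳ-inject₁ (_ ∷ xs) x (suc i) = lookup-∷ʳ-inject₁ xs x i

-- Membership by index, the form in which IsLocalLSeq refers to entries.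
infix 4 _∈ᵥ_

_∈ᵥ_ : A → Vec A k → Set
x ∈ᵥ xs = ∃[ i ] lookup xs i ≡ x

∉ᵥ[] : {x : A} → ¬ x ∈ᵥ []
∉ᵥ[] (() , _)

∈ᵥ-∷ : {x : A} (y : A) (xs : Vec A k) → x ∈ᵥ (y ∷ xs) ⇔ (x ≡ y ⊎ x ∈ᵥ xs)
∈ᵥ-∷ {x = x} y xs = mk⇔ split join
  where
  split : x ∈ᵥ (y ∷ xs) → x ≡ y ⊎ x ∈ᵥ xs
  split (zero  , y≡x) = inj₁ (≡-sym y≡x)
  split (suc i , eq)  = inj₂ (i , eq)
  join : x ≡ y ⊎ x ∈ᵥ xs → x ∈ᵥ (y ∷ xs)
  join (inj₁ refl)     = zero , refl
  join (inj₂ (i , eq)) = suc i , eq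

∈ᵥ-∷ʳ : {x : A} (xs : Vec A k) (y : A) → x ∈ᵥ (xs ∷ʳ y) ⇔ (x ≡ y ⊎ x ∈ᵥ xs)
∈ᵥ-∷ʳ {x = x} xs y = mk⇔ split join
  where
  split : x ∈ᵥ (xs ∷ʳ y) → x ≡ y ⊎ x ∈ᵥ xs
  split (i , eq) with view i
  ... | ‵fromℕ     = inj₁ (trans (≡-sym eq) (lookup-∷ʳ-fromℕ xs y))
  ... | ‵inject₁ j = inj₂ (j , trans (≡-sym (lookup-∷ʳ-inject₁ xs y j)) eq)
  join : x ≡ y ⊎ x ∈ᵥ xs → x ∈ᵥ (xs ∷ʳ y)
  join (inj₁ refl)     = fromℕ _ , lookup-∷ʳ-fromℕ xs y
  join (inj₂ (j , eq)) = inject₁ j , trans (lookup-∷ʳ-inject₁ xs y j) eq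

module _ (xs : Vec A k) (x : A) where

  Injective-init : Injective _≡_ _≡_ (lookup (xs ∷ʳ x)) → Injective _≡_ _≡_ (lookup xs)
  Injective-init inj {i} {j} eq = inject₁-injective (inj eq′)
    where
    eq′ : lookup (xs ∷ʳ x) (inject₁ i) ≡ lookup (xs ∷ʳ x) (inject₁ j)
    eq′ = trans (lookup-∷ʳ-inject₁ xs x i) (trans eq (≡-sym (lookup-∷ʳ-inject₁ xs x j)))

  Injective⇒last∉init : Injective _≡_ _≡_ (lookup (xs ∷ʳ x)) → ¬ x ∈ᵥ xs
  Injective⇒last∉init inj (j , eq) =
    fromℕ≢inject₁ (inj (trans (lookup-∷ʳ-fromℕ xs x) (≡-sym (trans (lookup-∷ʳ-inject₁ xs x j) eq))))

  Injective-∷ʳ : Injective _≡_ _≡_ (lookup xs) → ¬ x ∈ᵥ xs → Injective _≡_ _≡_ (lookup (xs ∷ʳ x))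
  Injective-∷ʳ inj x∉xs {i} {j} eq with view i | view j
  ... | ‵fromℕ     | ‵fromℕ     = refl
  ... | ‵fromℕ     | ‵inject₁ j′ =
    contradiction (j′ , trans (≡-sym (lookup-∷ʳ-inject₁ xs x j′)) (trans (≡-sym eq) (lookup-∷ʳ-fromℕ xs x)))
                  x∉xs
  ... | ‵inject₁ i′ | ‵fromℕ     =
    contradiction (i′ , trans (≡-sym (lookup-∷ʳ-inject₁ xs x i′)) (trans eq (lookup-∷ʳ-fromℕ xs x)))
                  x∉xs
  ... | ‵inject₁ i′ | ‵inject₁ j′ =
    cong inject₁ (inj (trans (≡-sym (lookup-∷ʳ-inject₁ xs x i′))
                             (trans eq (lookup-∷ʳ-inject₁ xs x j′))))

x∈p[y]≔inside⁻ : (p : Subset n) (x y : Fin n) → x ∈ p [ y ]≔ inside → x ≡ y ⊎ x ∈ p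
x∈p[y]≔inside⁻ (_ ∷ p) zero    zero    _         = inj₁ refl
x∈p[y]≔inside⁻ (_ ∷ p) zero    (suc y) here      = inj₂ here
x∈p[y]≔inside⁻ (_ ∷ p) (suc x) zero    (there h) = inj₂ (there h)
x∈p[y]≔inside⁻ (_ ∷ p) (suc x) (suc y) (there h) = Sum.map (cong suc) there (x∈p[y]≔inside⁻ p x y h)

x∈p[y]≔inside⁺ : (p : Subset n) (x y : Fin n) → x ≡ y ⊎ x ∈ p → x ∈ p [ y ]≔ inside
x∈p[y]≔inside⁺ p x y (inj₁ refl) = []≔-updates p y
x∈p[y]≔inside⁺ p x y (inj₂ x∈p) with x ≟ y
... | yes refl = []≔-updates p y
... | no  x≢y  = []≔-minimal p x y x≢y x∈p

∣p[x]≔inside∣ : (p : Subset n) (x : Fin n) → x ∉ p → ∣ p [ x ]≔ inside ∣ ≡ suc ∣ p ∣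
∣p[x]≔inside∣ (outside ∷ p) zero    _   = refl
∣p[x]≔inside∣ (inside  ∷ p) zero    x∉p = contradiction here x∉p
∣p[x]≔inside∣ (outside ∷ p) (suc x) x∉p = ∣p[x]≔inside∣ p x (x∉p ∘ there)
∣p[x]≔inside∣ (inside  ∷ p) (suc x) x∉p = cong suc (∣p[x]≔inside∣ p x (x∉p ∘ there))

Whites : Subset n → Vec (Fin n) k → Set
Whites c vs = ∀ x → x ∉ c ⇔ x ∈ᵥ vs

Whites[]⇒≡⊤ : {c : Subset n} → Whites c [] → c ≡ ⊤
Whites[]⇒≡⊤ {c = c} W = ⊆-antisym ⊆⊤ (λ {x} _ → decidable-stable (x ∈? c) (∉ᵥ[] ∘ to (W x)))

Whites-⊤ : Whites {n} ⊤ []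
Whites-⊤ x = mk⇔ (contradiction ∈⊤) (λ ())

module _ {c : Subset n} (vs : Vec (Fin n) k) (v : Fin n) where

  Whites-∷ʳ⁻ : ¬ v ∈ᵥ vs → Whites c (vs ∷ʳ v) → Whites (c [ v ]≔ inside) vs
  Whites-∷ʳ⁻ v∉vs W x = mk⇔ white⇒entry entry⇒white
    where
    white⇒entry : x ∉ c [ v ]≔ inside → x ∈ᵥ vs
    white⇒entry x∉c′ with to (∈ᵥ-∷ʳ vs v) (to (W x) (x∉c′ ∘ x∈p[y]≔inside⁺ c x v ∘ inj₂))
    ... | inj₁ refl = contradiction (x∈p[y]≔inside⁺ c x v (inj₁ refl)) x∉c′
    ... | inj₂ x∈vs = x∈vs
    entry⇒white : x ∈ᵥ vs → x ∉ c [ v ]≔ inside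
    entry⇒white x∈vs x∈c′ with x∈p[y]≔inside⁻ c x v x∈c′
    ... | inj₁ refl = v∉vs x∈vs
    ... | inj₂ x∈c  = from (W x) (from (∈ᵥ-∷ʳ vs v) (inj₂ x∈vs)) x∈c

  Whites-∷ʳ⁺ : v ∉ c → Whites (c [ v ]≔ inside) vs → Whites c (vs ∷ʳ v)
  Whites-∷ʳ⁺ v∉c W x = mk⇔ white⇒entry entry⇒white
    where
    white⇒entry : x ∉ c → x ∈ᵥ (vs ∷ʳ v)
    white⇒entry x∉c with x ≟ v
    ... | yes x≡v = from (∈ᵥ-∷ʳ vs v) (inj₁ x≡v)
    ... | no  x≢v = from (∈ᵥ-∷ʳ vs v) (inj₂ (to (W x) (Sum.[ x≢v , x∉c ] ∘ x∈p[y]≔inside⁻ c x v)))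
    entry⇒white : x ∈ᵥ (vs ∷ʳ v) → x ∉ c
    entry⇒white x∈vs′ with to (∈ᵥ-∷ʳ vs v) x∈vs′
    ... | inj₁ refl = v∉c
    ... | inj₂ x∈vs = from (W x) x∈vs ∘ x∈p[y]≔inside⁺ c x v ∘ inj₂

entries : Vec (Fin n) k → Subset n
entries []       = ∅
entries (v ∷ vs) = entries vs [ v ]≔ inside

∈-entries : (vs : Vec (Fin n) k) (x : Fin n) → x ∈ entries vs ⇔ x ∈ᵥ vs
∈-entries []       x = mk⇔ (⊥-elim ∘ ∉⊥) (⊥-elim ∘ ∉ᵥ[])
∈-entries (v ∷ vs) x = mk⇔
  (from (∈ᵥ-∷ v vs) ∘ Sum.map₂ (to (∈-entries vs x)) ∘ x∈p[y]≔inside⁻ (entries vs) x v)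
  (x∈p[y]≔inside⁺ (entries vs) x v ∘ Sum.map₂ (from (∈-entries vs x)) ∘ to (∈ᵥ-∷ v vs))

Whites-∁entries : (vs : Vec (Fin n) k) → Whites (∁ (entries vs)) vs
Whites-∁entries vs x = mk⇔ (to (∈-entries vs x) ∘ x∉∁p⇒x∈p) (x∈p⇒x∉∁p ∘ from (∈-entries vs x))

Whites⇒∣c∣+k≡n : {c : Subset n} (vs : Vec (Fin n) k) →
                 Injective _≡_ _≡_ (lookup vs) → Whites c vs → ∣ c ∣ + k ≡ n
Whites⇒∣c∣+k≡n {n} {zero} [] _ W with Whites[]⇒≡⊤ W
... | refl = trans (ℕₚ.+-identityʳ _) (∣⊤∣≡n n)
Whites⇒∣c∣+k≡n {n} {suc k} {c} vs inj W with initLast vs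
... | ys , y , refl = begin
  ∣ c ∣ + suc k            ≡⟨ ℕₚ.+-suc ∣ c ∣ k ⟩
  suc ∣ c ∣ + k            ≡⟨ cong (_+ k) (≡-sym (∣p[x]≔inside∣ c y y∉c)) ⟩
  ∣ c [ y ]≔ inside ∣ + k  ≡⟨ Whites⇒∣c∣+k≡n ys (Injective-init ys y inj) (Whites-∷ʳ⁻ ys y y∉ys W) ⟩
  n                        ∎
  where
  open ≡-Reasoning
  y∉ys : ¬ y ∈ᵥ ys
  y∉ys = Injective⇒last∉init ys y inj
  y∉c : y ∉ c
  y∉c = from (W y) (from (∈ᵥ-∷ʳ ys y) (inj₁ refl))

module _ (G : Graph n) where

  Adj-sym : {u v : Fin n} → Adj G u v → Adj G v u
  Adj-sym {u} {v} = subst T (sym G u v)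

  Adj-irrefl : {v : Fin n} → ¬ Adj G v v
  Adj-irrefl {v} = subst T (irrefl G v)

  NoNbrIn : Vec (Fin n) k → Fin n → Set
  NoNbrIn vs u = ∀ x → x ∈ᵥ vs → ¬ Adj G x u

  -- The local L-sequence condition at a vertex v appended to vs: its witness u is v itself
  -- (a D-rule at v) or an entry of vs adjacent to v (a T-rule at u).
  data Extends (vs : Vec (Fin n) k) (v : Fin n) : Set where
    self      : NoNbrIn vs v → Extends vs v
    neighbour : {u : Fin n} → u ∈ᵥ vs → Adj G v u → NoNbrIn vs u → Extends vs v

  EntryUpTo : Vec (Fin n) k → Fin k → Fin n → Set
  EntryUpTo vs i u = ∃[ j ] (j ≤ i × lookup vs j ≡ u)

  NoNbrBefore : Vec (Fin n) k → Fin k → Fin n → Set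
  NoNbrBefore vs i u = ∀ j → j < i → ¬ Adj G (lookup vs j) u

  LocalCondition : Vec (Fin n) k → Fin k → Set
  LocalCondition vs i = ∃[ u ] (ClosedNbr G (lookup vs i) u × EntryUpTo vs i u × NoNbrBefore vs i u)

  module _ (vs : Vec (Fin n) k) (v : Fin n) where

    Extends⇔witness : Extends vs v ⇔ (∃[ u ] (ClosedNbr G v u × u ∈ᵥ (vs ∷ʳ v) × NoNbrIn vs u))
    Extends⇔witness = mk⇔ witness extends
      where
      witness : Extends vs v → ∃[ u ] (ClosedNbr G v u × u ∈ᵥ (vs ∷ʳ v) × NoNbrIn vs u)
      witness (self h)             = v , inj₁ refl , from (∈ᵥ-∷ʳ vs v) (inj₁ refl) , h
      witness (neighbour u∈vs a h) = _ , inj₂ a , from (∈ᵥ-∷ʳ vs v) (inj₂ u∈vs) , h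
      extends : ∃[ u ] (ClosedNbr G v u × u ∈ᵥ (vs ∷ʳ v) × NoNbrIn vs u) → Extends vs v
      extends (_ , inj₁ refl , _ , h) = self h
      extends (u , inj₂ a , u∈vs′ , h) with to (∈ᵥ-∷ʳ vs v) u∈vs′
      ... | inj₁ refl = contradiction a Adj-irrefl
      ... | inj₂ u∈vs = neighbour u∈vs a h

    EntryUpTo-inject₁ : ∀ i u → EntryUpTo (vs ∷ʳ v) (inject₁ i) u ⇔ EntryUpTo vs i u
    EntryUpTo-inject₁ i u = mk⇔ lower raise
      where
      lower : EntryUpTo (vs ∷ʳ v) (inject₁ i) u → EntryUpTo vs i u
      lower (j , j≤i , eq) with view j
      ... | ‵fromℕ     = contradiction j≤i (fromℕ≰inject₁ i)
      ... | ‵inject₁ j′ = j′ , inject₁-cancel-≤ j≤i , trans (≡-sym (lookup-∷ʳ-inject₁ vs v j′)) eq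
      raise : EntryUpTo vs i u → EntryUpTo (vs ∷ʳ v) (inject₁ i) u
      raise (j , j≤i , eq) = inject₁ j , inject₁-mono-≤ j≤i , trans (lookup-∷ʳ-inject₁ vs v j) eq

    EntryUpTo-fromℕ : ∀ u → EntryUpTo (vs ∷ʳ v) (fromℕ k) u ⇔ u ∈ᵥ (vs ∷ʳ v)
    EntryUpTo-fromℕ u = mk⇔ (λ (j , _ , eq) → j , eq) (λ (j , eq) → j , ≤fromℕ j , eq)

    NoNbrBefore-inject₁ : ∀ i u → NoNbrBefore (vs ∷ʳ v) (inject₁ i) u ⇔ NoNbrBefore vs i u
    NoNbrBefore-inject₁ i u = mk⇔ lower raise
      where
      lower : NoNbrBefore (vs ∷ʳ v) (inject₁ i) u → NoNbrBefore vs i u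
      lower h j j<i =
        subst (λ x → ¬ Adj G x u) (lookup-∷ʳ-inject₁ vs v j) (h (inject₁ j) (inject₁-mono-< j<i))
      raise : NoNbrBefore vs i u → NoNbrBefore (vs ∷ʳ v) (inject₁ i) u
      raise h j j<i with view j
      ... | ‵fromℕ     = contradiction (ℕₚ.<⇒≤ j<i) (fromℕ≰inject₁ i)
      ... | ‵inject₁ j′ =
        subst (λ x → ¬ Adj G x u) (≡-sym (lookup-∷ʳ-inject₁ vs v j′)) (h j′ (inject₁-cancel-< j<i))

    NoNbrBefore-fromℕ : ∀ u → NoNbrBefore (vs ∷ʳ v) (fromℕ k) u ⇔ NoNbrIn vs u
    NoNbrBefore-fromℕ u = mk⇔ lower raise
      where
      lower : NoNbrBefore (vs ∷ʳ v) (fromℕ k) u → NoNbrIn vs u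
      lower h _ (j , refl) =
        subst (λ x → ¬ Adj G x u) (lookup-∷ʳ-inject₁ vs v j) (h (inject₁ j) (inject₁<fromℕ j))
      raise : NoNbrIn vs u → NoNbrBefore (vs ∷ʳ v) (fromℕ k) u
      raise h j j<k with view j
      ... | ‵fromℕ     = contradiction j<k (<-irrefl refl)
      ... | ‵inject₁ j′ = h _ (j′ , ≡-sym (lookup-∷ʳ-inject₁ vs v j′))

    LocalCondition-inject₁ : ∀ i → LocalCondition (vs ∷ʳ v) (inject₁ i) ⇔ LocalCondition vs i
    LocalCondition-inject₁ i = mk⇔
      (λ (u , u∈N , up , before) →
        u , subst (λ x → ClosedNbr G x u) lookup-inject₁ u∈N ,
        to (EntryUpTo-inject₁ i u) up , to (NoNbrBefore-inject₁ i u) before)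
      (λ (u , u∈N , up , before) →
        u , subst (λ x → ClosedNbr G x u) (≡-sym lookup-inject₁) u∈N ,
        from (EntryUpTo-inject₁ i u) up , from (NoNbrBefore-inject₁ i u) before)
      where
      lookup-inject₁ : lookup (vs ∷ʳ v) (inject₁ i) ≡ lookup vs i
      lookup-inject₁ = lookup-∷ʳ-inject₁ vs v i

    LocalCondition-fromℕ : LocalCondition (vs ∷ʳ v) (fromℕ k) ⇔ Extends vs v
    LocalCondition-fromℕ = mk⇔
      (λ (u , u∈N , up , before) → from Extends⇔witness
        (u , subst (λ x → ClosedNbr G x u) lookup-fromℕ u∈N ,
         to (EntryUpTo-fromℕ u) up , to (NoNbrBefore-fromℕ u) before))
      (λ ext → let (u , u∈N , u∈vs′ , h) = to Extends⇔witness ext in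
        u , subst (λ x → ClosedNbr G x u) (≡-sym lookup-fromℕ) u∈N ,
        from (EntryUpTo-fromℕ u) u∈vs′ , from (NoNbrBefore-fromℕ u) h)
      where
      lookup-fromℕ : lookup (vs ∷ʳ v) (fromℕ k) ≡ v
      lookup-fromℕ = lookup-∷ʳ-fromℕ vs v

    IsLocalLSeq-init : IsLocalLSeq G (vs ∷ʳ v) → IsLocalLSeq G vs
    IsLocalLSeq-init (inj , L) =
      Injective-init vs v inj , λ i → to (LocalCondition-inject₁ i) (L (inject₁ i))

    IsLocalLSeq-last : IsLocalLSeq G (vs ∷ʳ v) → Extends vs v
    IsLocalLSeq-last (_ , L) = to LocalCondition-fromℕ (L (fromℕ k))

    IsLocalLSeq-∷ʳ : IsLocalLSeq G vs → ¬ v ∈ᵥ vs → Extends vs v → IsLocalLSeq G (vs ∷ʳ v)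
    IsLocalLSeq-∷ʳ (inj , L) v∉vs ext = Injective-∷ʳ vs v inj v∉vs , condition
      where
      condition : ∀ i → LocalCondition (vs ∷ʳ v) i
      condition i with view i
      ... | ‵fromℕ     = from LocalCondition-fromℕ ext
      ... | ‵inject₁ i′ = from (LocalCondition-inject₁ i′) (L i′)

  CanColor⇒white : {c : Subset n} {w : Fin n} → CanColor G c w → w ∉ c
  CanColor⇒white (T-rule _ _ _ w∉c _ _) = w∉c
  CanColor⇒white (D-rule _ w∉c _)       = w∉c

  module _ {c : Subset n} (vs : Vec (Fin n) k) (v : Fin n) (W : Whites c (vs ∷ʳ v)) where

    private
      white⇒entry : ∀ {x} → x ∉ c → x ≡ v ⊎ x ∈ᵥ vs
      white⇒entry {x} = to (∈ᵥ-∷ʳ vs v) ∘ to (W x)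

      entry⇒white : ∀ {x} → x ∈ᵥ vs → x ∉ c
      entry⇒white {x} = from (W x) ∘ from (∈ᵥ-∷ʳ vs v) ∘ inj₂

      last-white : v ∉ c
      last-white = from (W v) (from (∈ᵥ-∷ʳ vs v) (inj₁ refl))

    Extends⇒CanColor : Extends vs v → CanColor G c v
    Extends⇒CanColor (self h) = D-rule v last-white blue
      where
      blue : ∀ u → Adj G v u → u ∈ c
      blue u a = decidable-stable (u ∈? c) λ u∉c → case-white (white⇒entry u∉c)
        where
        case-white : u ≡ v ⊎ u ∈ᵥ vs → ⊥
        case-white (inj₁ refl) = Adj-irrefl a
        case-white (inj₂ u∈vs) = h u u∈vs (Adj-sym a)
    Extends⇒CanColor (neighbour {u} u∈vs a h) =
      T-rule u v (entry⇒white u∈vs) last-white (Adj-sym a) onlyWhiteNbr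
      where
      onlyWhiteNbr : ∀ x → Adj G u x → x ∉ c → x ≡ v
      onlyWhiteNbr x a′ x∉c with white⇒entry x∉c
      ... | inj₁ x≡v  = x≡v
      ... | inj₂ x∈vs = contradiction (Adj-sym a′) (h x x∈vs)

    CanColor⇒Extends : ¬ v ∈ᵥ vs → CanColor G c v → Extends vs v
    CanColor⇒Extends _ (D-rule _ _ blue) = self λ x x∈vs a → entry⇒white x∈vs (blue x (Adj-sym a))
    CanColor⇒Extends v∉vs (T-rule u _ u∉c _ a onlyWhiteNbr) with white⇒entry u∉c
    ... | inj₁ refl = contradiction a Adj-irrefl
    ... | inj₂ u∈vs = neighbour u∈vs (Adj-sym a) λ x x∈vs a′ →
      v∉vs (subst (_∈ᵥ vs) (onlyWhiteNbr x (Adj-sym a′) (entry⇒white x∈vs)) x∈vs)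

  IsLocalLSeq⇒Forces : {c : Subset n} (vs : Vec (Fin n) k) →
                       IsLocalLSeq G vs → Whites c vs → Forces G c ⊤
  IsLocalLSeq⇒Forces {zero} [] _ W with Whites[]⇒≡⊤ W
  ... | refl = done
  IsLocalLSeq⇒Forces {suc k} vs L W with initLast vs
  ... | ys , y , refl =
    step y (Extends⇒CanColor ys y W (IsLocalLSeq-last ys y L))
           (IsLocalLSeq⇒Forces ys (IsLocalLSeq-init ys y L) (Whites-∷ʳ⁻ ys y y∉ys W))
    where
    y∉ys : ¬ y ∈ᵥ ys
    y∉ys = Injective⇒last∉init ys y (proj₁ L)

  Forces⇒IsLocalLSeq : {c : Subset n} → Forces G c ⊤ →
                       ∃₂ λ k (vs : Vec (Fin n) k) → IsLocalLSeq G vs × Whites c vs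
  Forces⇒IsLocalLSeq done = 0 , [] , ((λ { {()} }) , λ ()) , Whites-⊤
  Forces⇒IsLocalLSeq {c} (step w cw rest) with Forces⇒IsLocalLSeq rest
  ... | k , vs , L , W =
    suc k , vs ∷ʳ w , IsLocalLSeq-∷ʳ vs w L w∉vs (CanColor⇒Extends vs w W′ w∉vs cw) , W′
    where
    W′ : Whites c (vs ∷ʳ w)
    W′ = Whites-∷ʳ⁺ vs w (CanColor⇒white cw) W
    w∉vs : ¬ w ∈ᵥ vs
    w∉vs w∈vs = from (W w) w∈vs ([]≔-updates c w)

theorem23 : ∀ {n : ℕ} (G : Graph n) (k : ℕ) →
    (∃[ vs ] IsLocalLSeq {n} {k} G vs) ⇔ (∃[ S ] (∣ S ∣ + k ≡ n × IsTDForcing G S))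
theorem23 {n} G k = mk⇔ sequence⇒forcingSet forcingSet⇒sequence
  where
  sequence⇒forcingSet : ∃[ vs ] IsLocalLSeq G vs → ∃[ S ] (∣ S ∣ + k ≡ n × IsTDForcing G S)
  sequence⇒forcingSet (vs , L) =
    ∁ (entries vs) , Whites⇒∣c∣+k≡n vs (proj₁ L) W , IsLocalLSeq⇒Forces G vs L W
    where
    W : Whites (∁ (entries vs)) vs
    W = Whites-∁entries vs

  forcingSet⇒sequence : ∃[ S ] (∣ S ∣ + k ≡ n × IsTDForcing G S) → ∃[ vs ] IsLocalLSeq G vs
  forcingSet⇒sequence (S , ∣S∣+k≡n , F) with Forces⇒IsLocalLSeq G F
  ... | k′ , vs , L , W
    with ℕₚ.+-cancelˡ-≡ ∣ S ∣ k′ k (trans (Whites⇒∣c∣+k≡n vs (proj₁ L) W) (≡-sym ∣S∣+k≡n))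
  ... | refl = vs , L
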